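{- For all integers $n,\alpha,\beta\ge 0$, parallelogram polyominoes of semi-perimeter $n+2$ whose top row has exactly $\alpha+1$ cells and whose rightmost column has exactly $\beta+1$ cells are in bijection with pairs $(F_e,F_s)$ of ordered forests such that $F_e$ has exactly $\alpha$ trees, $F_s$ has exactly $\beta$ trees, and the sum of the sizes of $F_e$ and $F_s$ equals $n$.
   Context: A cell is a unit square of $\mathbb{Z}\times\mathbb{Z}$; a polyomino is a finite connected union of cells, up to translation. A parallelogram polyomino is a polyomino whose boundary decomposes into two lattice paths (upper and lower) made of north and east unit steps that meet only at their common starting and ending points. Semi-perimeter: half the perimeter (equal to number of rows plus number of columns). An ordered tree is a rooted tree with a specified ordering of the children of each vertex; its size is its number of nodes. An ordered forest is a finite (possibly empty) sequence of ordered trees; its size is the total number of nodes. -}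

module Defs where

open import Data.Nat using (ℕ; zero; suc; _+_; _≡ᵇ_; _≤ᵇ_)
open import Data.Bool using (Bool; true; false; _∧_; _∨_; not; T)
open import Data.List using (List; []; _∷_; length; take; reverse; upTo)
open import Data.Product using (_×_; _,_)
open import Relation.Binary.PropositionalEquality using (_≡_)

-- Lattice paths made of north / east unit steps, starting at the origin
-- (fixing the start point at the origin is the "up to translation").

data Step : Set where
  N E : Step

Path : Set
Path = List Step

countN : Path → ℕ
countN []      = 0
countN (N ∷ p) = suc (countN p)
countN (E ∷ p) = countN p

countE : Path → ℕ
countE []      = 0
countE (N ∷ p) = countE p
countE (E ∷ p) = suc (countE p)

pointAt : Path → ℕ → ℕ × ℕ
pointAt p k = countE (take k p) , countN (take k p)

samePoint : ℕ × ℕ → ℕ × ℕ → Bool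
samePoint (a , b) (c , d) = (a ≡ᵇ c) ∧ (b ≡ᵇ d)

allB : {A : Set} → (A → Bool) → List A → Bool
allB f []       = true
allB f (x ∷ xs) = f x ∧ allB f xs

range : ℕ → List ℕ
range m = upTo (suc m)

meetOnlyAtEnds : Path → Path → Bool
meetOnlyAtEnds u l =
  allB (λ i → allB (λ j →
        not (samePoint (pointAt u i) (pointAt l j))
        ∨ ((i ≡ᵇ 0) ∧ (j ≡ᵇ 0))
        ∨ ((i ≡ᵇ length u) ∧ (j ≡ᵇ length l)))
      (range (length l)))
    (range (length u))

weaklyAbove : Path → Path → Bool
weaklyAbove u l = allB (λ k → countN (take k l) ≤ᵇ countN (take k u)) (range (length u))

isParallelogram : Path → Path → Bool
isParallelogram u l =
  (length u ≡ᵇ length l) ∧ (countN u ≡ᵇ countN l) ∧ not (length u ≡ᵇ 0)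
  ∧ meetOnlyAtEnds u l ∧ weaklyAbove u l

trailingE : Path → ℕ
trailingE p = go (reverse p)
  where
  go : Path → ℕ
  go (E ∷ q) = suc (go q)
  go _       = 0

trailingN : Path → ℕ
trailingN p = go (reverse p)
  where
  go : Path → ℕ
  go (N ∷ q) = suc (go q)
  go _       = 0

record ParallelogramPolyomino : Set where
  constructor pp
  field
    upper : Path
    lower : Path
    valid : T (isParallelogram upper lower)
open ParallelogramPolyomino public

-- semi-perimeter = #rows + #columns = length of either boundary path
semiPerimeter : ParallelogramPolyomino → ℕ
semiPerimeter P = length (upper P)

-- number of cells of the top row: the top row extends from where the upper
-- path reaches the maximal height (its last N step) to the right end
topRowCells : ParallelogramPolyomino → ℕ
topRowCells P = trailingE (upper P)

-- number of cells of the rightmost column: from where the lower path reaches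
-- the maximal abscissa (its last E step) to the top
rightColumnCells : ParallelogramPolyomino → ℕ
rightColumnCells P = trailingN (lower P)

record PP (n α β : ℕ) : Set where
  constructor mkPP
  field
    poly     : ParallelogramPolyomino
    semiPer  : semiPerimeter poly ≡ n + 2
    topRow   : topRowCells poly ≡ suc α
    rightCol : rightColumnCells poly ≡ suc β

data Tree : Set where
  node : List Tree → Tree

Forest : Set
Forest = List Tree

mutual
  treeSize : Tree → ℕ
  treeSize (node ts) = suc (forestSize ts)

  forestSize : Forest → ℕ
  forestSize []       = 0
  forestSize (t ∷ ts) = treeSize t + forestSize ts

record ForestPair (n α β : ℕ) : Set where
  constructor mkFP
  field
    Fe     : Forest
    Fs     : Forest
    treesE : length Fe ≡ α
    treesS : length Fs ≡ β
    size   : forestSize Fe + forestSize Fs ≡ n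

module Submission where

-- Idea: the boundary of a parallelogram polyomino of semi-perimeter n + 2 is N·w·E over E·w′·N, where the
-- inner paths w, w′ have length n, end at the same point, and w′ stays weakly below w.  Reading the inner
-- paths from their start, keep a stack of pairs of forests whose height is the current gap between w and w′:
-- a step that widens the gap pushes an empty pair, a step that narrows it grafts the top two pairs
-- together, and parallel steps create a new root in the top pair.  The stack ends as one pair of forests of
-- total size n, in which the final run of E steps of w and of N steps of w′ (one less than the top row and
-- the rightmost column) are the depths of the leftmost branches.  The rotation correspondence of ordered
-- forests, which turns the leftmost branch into the sequence of roots, makes these depths numbers of trees.

open import Defs
open import Data.Bool using (Bool; true; false; _∧_; _∨_; not; T)
open import Data.Bool.Properties using (T-∧; T-∨; T-irrelevant)
open import Data.List using (List; []; _∷_; length; take; reverse; _++_; _∷ʳ_; initLast; _∷ʳ′_)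
open import Data.List.Membership.Propositional using (_∈_)
open import Data.List.Membership.Propositional.Properties using (∈-upTo⁺; ∈-upTo⁻)
open import Data.List.Properties
  using (unfold-reverse; reverse-involutive; reverse-++; length-reverse; length-++; take-all; ∷-injectiveʳ; ∷ʳ-injectiveˡ)
open import Data.List.Relation.Unary.Any using (here; there)
open import Data.Nat using (ℕ; zero; suc; _+_; _∸_; _≤_; _<_; z≤n; s≤s; _≡ᵇ_; _≤ᵇ_; _≤?_; _≟_)
open import Data.Nat.Properties
open import Data.Nat.Tactic.RingSolver using (solve-∀)
open import Data.Product using (Σ; _×_; _,_; proj₁; proj₂)
open import Data.Sum using (_⊎_; inj₁; inj₂)
open import Data.Vec using (Vec; []; _∷_; head)
open import Function.Base using (_∘′_)
open import Function.Bundles using (Equivalence; _↔_; _⤖_; mk↔ₛ′)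
open import Function.Properties.Inverse using (↔⇒⤖; ↔-trans)
open import Relation.Nullary using (yes; no; contradiction)
open import Relation.Binary.PropositionalEquality

prefixN : ℕ → Path → ℕ
prefixN k p = countN (take k p)

countN-++ : ∀ xs ys → countN (xs ++ ys) ≡ countN xs + countN ys
countN-++ []       ys = refl
countN-++ (N ∷ xs) ys = cong suc (countN-++ xs ys)
countN-++ (E ∷ xs) ys = countN-++ xs ys

countN-reverse : ∀ p → countN (reverse p) ≡ countN p
countN-reverse []      = refl
countN-reverse (x ∷ p) = begin
  countN (reverse (x ∷ p))          ≡⟨ cong countN (unfold-reverse x p) ⟩
  countN (reverse p ++ x ∷ [])      ≡⟨ countN-++ (reverse p) (x ∷ []) ⟩
  countN (reverse p) + countN (x ∷ []) ≡⟨ cong (_+ countN (x ∷ [])) (countN-reverse p) ⟩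
  countN p + countN (x ∷ [])        ≡⟨ +-comm (countN p) _ ⟩
  countN (x ∷ []) + countN p        ≡⟨ countN-++ (x ∷ []) p ⟨
  countN (x ∷ p)                    ∎
  where open ≡-Reasoning

prefixN-++ : ∀ k xs ys → prefixN k (xs ++ ys) ≡ prefixN k xs + prefixN (k ∸ length xs) ys
prefixN-++ zero    []       ys = refl
prefixN-++ zero    (_ ∷ _)  ys = refl
prefixN-++ (suc k) []       ys = refl
prefixN-++ (suc k) (N ∷ xs) ys = cong suc (prefixN-++ k xs ys)
prefixN-++ (suc k) (E ∷ xs) ys = prefixN-++ k xs ys

prefixN-all : ∀ k p → length p ≤ k → prefixN k p ≡ countN p
prefixN-all k p len≤k = cong countN (take-all k p len≤k)

prefixN-≤-extend : ∀ {p q} → length p ≡ length q →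
                   (∀ k → k ≤ length q → prefixN k p ≤ prefixN k q) → ∀ k → prefixN k p ≤ prefixN k q
prefixN-≤-extend {p} {q} len≡ p≤q k with k ≤? length q
... | yes k≤ = p≤q k k≤
... | no k≰  = begin
  prefixN k p          ≡⟨ prefixN-all k p (subst (_≤ k) (sym len≡) len≤k) ⟩
  countN p             ≡⟨ prefixN-all (length q) p (≤-reflexive len≡) ⟨
  prefixN (length q) p ≤⟨ p≤q (length q) ≤-refl ⟩
  prefixN (length q) q ≡⟨ prefixN-all (length q) q ≤-refl ⟩
  countN q             ≡⟨ prefixN-all k q len≤k ⟨
  prefixN k q          ∎
  where
  open ≤-Reasoning
  len≤k = <⇒≤ (≰⇒> k≰)

prefixN-∷ʳ : ∀ k xs y → k ≤ length xs → prefixN k (xs ∷ʳ y) ≡ prefixN k xs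
prefixN-∷ʳ k xs y k≤ = begin
  prefixN k (xs ∷ʳ y)                                    ≡⟨ prefixN-++ k xs (y ∷ []) ⟩
  prefixN k xs + prefixN (k ∸ length xs) (y ∷ [])
    ≡⟨ cong (λ j → prefixN k xs + prefixN j (y ∷ [])) (m≤n⇒m∸n≡0 k≤) ⟩
  prefixN k xs + 0                                       ≡⟨ +-identityʳ _ ⟩
  prefixN k xs                                           ∎
  where open ≡-Reasoning

prefixN-reverse : ∀ k m p → k + m ≡ length p → prefixN k (reverse p) + prefixN m p ≡ countN p
prefixN-reverse k zero p k≡len = begin
  prefixN k (reverse p) + 0 ≡⟨ +-identityʳ _ ⟩
  prefixN k (reverse p)     ≡⟨ prefixN-all k (reverse p) (≤-reflexive len≡k) ⟩
  countN (reverse p)        ≡⟨ countN-reverse p ⟩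
  countN p                  ∎
  where
  open ≡-Reasoning
  len≡k : length (reverse p) ≡ k
  len≡k = trans (length-reverse p) (trans (sym k≡len) (+-identityʳ k))
prefixN-reverse k (suc m) [] k+m≡0 with () ← trans (sym (+-suc k m)) k+m≡0
prefixN-reverse k (suc m) (x ∷ p) k+m≡len = begin
  prefixN k (reverse (x ∷ p)) + prefixN (suc m) (x ∷ p)
    ≡⟨ cong (_+ prefixN (suc m) (x ∷ p))
            (trans (cong (prefixN k) (unfold-reverse x p)) (prefixN-∷ʳ k (reverse p) x k≤)) ⟩
  prefixN k (reverse p) + prefixN (suc m) (x ∷ p)
    ≡⟨ step x ⟩
  countN (x ∷ p) ∎
  where
  open ≡-Reasoning
  k+m≡len′ : k + m ≡ length p
  k+m≡len′ = suc-injective (trans (sym (+-suc k m)) k+m≡len)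
  k≤ : k ≤ length (reverse p)
  k≤ = subst (k ≤_) (trans k+m≡len′ (sym (length-reverse p))) (m≤m+n k m)
  step : ∀ x → prefixN k (reverse p) + prefixN (suc m) (x ∷ p) ≡ countN (x ∷ p)
  step N = trans (+-suc _ _) (cong suc (prefixN-reverse k m p k+m≡len′))
  step E = prefixN-reverse k m p k+m≡len′

prefixE : ℕ → Path → ℕ
prefixE k p = countE (take k p)

prefixE+prefixN : ∀ k p → k ≤ length p → prefixE k p + prefixN k p ≡ k
prefixE+prefixN zero    p       _         = refl
prefixE+prefixN (suc k) (N ∷ p) (s≤s k≤) = trans (+-suc (prefixE k p) _) (cong suc (prefixE+prefixN k p k≤))
prefixE+prefixN (suc k) (E ∷ p) (s≤s k≤) = cong suc (prefixE+prefixN k p k≤)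

length-∷ʳ : ∀ (xs : Path) y → length (xs ∷ʳ y) ≡ suc (length xs)
length-∷ʳ xs y = trans (length-++ xs) (+-comm (length xs) 1)

prefixN-one : ∀ k y → prefixN k (y ∷ []) ≤ 1
prefixN-one zero    _ = z≤n
prefixN-one (suc k) N = ≤-reflexive (cong suc (prefixN-all k [] z≤n))
prefixN-one (suc k) E = ≤-trans (≤-reflexive (prefixN-all k [] z≤n)) z≤n

prefixN-∷ʳ-≤ : ∀ k xs y → prefixN k (xs ∷ʳ y) ≤ suc (prefixN k xs)
prefixN-∷ʳ-≤ k xs y = begin
  prefixN k (xs ∷ʳ y)                              ≡⟨ prefixN-++ k xs (y ∷ []) ⟩
  prefixN k xs + prefixN (k ∸ length xs) (y ∷ [])  ≤⟨ +-monoʳ-≤ (prefixN k xs) (prefixN-one (k ∸ length xs) y) ⟩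
  prefixN k xs + 1                                 ≡⟨ +-comm (prefixN k xs) 1 ⟩
  suc (prefixN k xs)                               ∎
  where open ≤-Reasoning

≤-prefixN-∷ʳ : ∀ k xs y → prefixN k xs ≤ prefixN k (xs ∷ʳ y)
≤-prefixN-∷ʳ k xs y = subst (prefixN k xs ≤_) (sym (prefixN-++ k xs (y ∷ []))) (m≤m+n _ _)

record Parallelogram (u l : Path) : Set where
  field
    sameLength : length u ≡ length l
    sameHeight : countN u ≡ countN l
    nonempty   : 0 < length u
    apart      : ∀ i → 0 < i → i < length u → prefixN i u ≢ prefixN i l
    lowerBelow : ∀ k → prefixN k l ≤ prefixN k u

private
  split-∧ : ∀ x {y} → T (x ∧ y) → T x × T y
  split-∧ _ = Equivalence.to T-∧

  join-∧ : ∀ {x y} → T x → T y → T (x ∧ y)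
  join-∧ tx ty = Equivalence.from T-∧ (tx , ty)

  allB⁻ : ∀ {A : Set} (f : A → Bool) xs → T (allB f xs) → ∀ {x} → x ∈ xs → T (f x)
  allB⁻ f (x ∷ _)  t (here refl) = proj₁ (split-∧ (f x) t)
  allB⁻ f (x ∷ xs) t (there x∈)  = allB⁻ f xs (proj₂ (split-∧ (f x) t)) x∈

  allB⁺ : ∀ {A : Set} (f : A → Bool) xs → (∀ {x} → x ∈ xs → T (f x)) → T (allB f xs)
  allB⁺ f []       _  = _
  allB⁺ f (_ ∷ xs) fx = join-∧ (fx (here refl)) (allB⁺ f xs (fx ∘′ there))

  allB-range⁻ : ∀ m (f : ℕ → Bool) → T (allB f (range m)) → ∀ i → i ≤ m → T (f i)
  allB-range⁻ m f t i i≤m = allB⁻ f (range m) t (∈-upTo⁺ (s≤s i≤m))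

  allB-range⁺ : ∀ m (f : ℕ → Bool) → (∀ i → i ≤ m → T (f i)) → T (allB f (range m))
  allB-range⁺ m f fi = allB⁺ f (range m) (λ {i} i∈ → fi i (≤-pred (∈-upTo⁻ i∈)))

  meetEntry : Path → Path → ℕ → ℕ → Bool
  meetEntry u l i j = not (samePoint (pointAt u i) (pointAt l j))
                      ∨ ((i ≡ᵇ 0) ∧ (j ≡ᵇ 0)) ∨ ((i ≡ᵇ length u) ∧ (j ≡ᵇ length l))

  entry⇒ends : ∀ {x y z} → T (not x ∨ y ∨ z) → T x → T y ⊎ T z
  entry⇒ends {true} t _ = Equivalence.to T-∨ t

  ends⇒entry : ∀ {x y z} → (T x → T y ⊎ T z) → T (not x ∨ y ∨ z)
  ends⇒entry {false} _    = _
  ends⇒entry {true}  ends = Equivalence.from T-∨ (ends _)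

samePoint⇒sameIndex : ∀ u l i j → i ≤ length u → j ≤ length l →
                      T (samePoint (pointAt u i) (pointAt l j)) → i ≡ j × prefixN i u ≡ prefixN j l
samePoint⇒sameIndex u l i j i≤ j≤ same = i≡j , sameN
  where
  sameE = ≡ᵇ⇒≡ (prefixE i u) (prefixE j l) (proj₁ (split-∧ (prefixE i u ≡ᵇ prefixE j l) same))
  sameN = ≡ᵇ⇒≡ (prefixN i u) (prefixN j l) (proj₂ (split-∧ (prefixE i u ≡ᵇ prefixE j l) same))
  i≡j = trans (sym (prefixE+prefixN i u i≤)) (trans (cong₂ _+_ sameE sameN) (prefixE+prefixN j l j≤))

sameHeight⇒samePoint : ∀ u l i → i ≤ length u → i ≤ length l →
                       prefixN i u ≡ prefixN i l → T (samePoint (pointAt u i) (pointAt l i))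
sameHeight⇒samePoint u l i i≤u i≤l sameN = join-∧ (≡⇒≡ᵇ _ _ sameE) (≡⇒≡ᵇ _ _ sameN)
  where
  sameE : prefixE i u ≡ prefixE i l
  sameE = +-cancelʳ-≡ (prefixN i u) _ _
            (trans (prefixE+prefixN i u i≤u) (trans (sym (prefixE+prefixN i l i≤l)) (cong (prefixE i l +_) (sym sameN))))

isParallelogram⇒Parallelogram : ∀ u l → T (isParallelogram u l) → Parallelogram u l
isParallelogram⇒Parallelogram u l t
  with tLen      , t₁     ← split-∧ (length u ≡ᵇ length l) t
  with tHeight   , t₂     ← split-∧ (countN u ≡ᵇ countN l) t₁
  with tNonempty , t₃     ← split-∧ (not (length u ≡ᵇ 0)) t₂
  with tMeet     , tAbove ← split-∧ (meetOnlyAtEnds u l) t₃ = record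
  { sameLength = sameLength
  ; sameHeight = ≡ᵇ⇒≡ _ _ tHeight
  ; nonempty   = nonzero (length u) tNonempty
  ; apart      = apart
  ; lowerBelow = lowerBelow
  }
  where
  sameLength : length u ≡ length l
  sameLength = ≡ᵇ⇒≡ _ _ tLen

  meetRow : ∀ i → i ≤ length u → T (allB (meetEntry u l i) (range (length l)))
  meetRow = allB-range⁻ (length u) (λ i → allB (meetEntry u l i) (range (length l))) tMeet

  nonzero : ∀ m → T (not (m ≡ᵇ 0)) → 0 < m
  nonzero (suc m) _ = s≤s z≤n

  apart : ∀ i → 0 < i → i < length u → prefixN i u ≢ prefixN i l
  apart i 0<i i<u sameN with entry⇒ends entry (sameHeight⇒samePoint u l i (<⇒≤ i<u) i≤l sameN)
    where
    i≤l = subst (i ≤_) sameLength (<⇒≤ i<u)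
    entry = allB-range⁻ (length l) (meetEntry u l i) (meetRow i (<⇒≤ i<u)) i i≤l
  ... | inj₁ starts = contradiction (≡ᵇ⇒≡ i 0 (proj₁ (split-∧ (i ≡ᵇ 0) starts))) (>⇒≢ 0<i)
  ... | inj₂ ends   = contradiction (≡ᵇ⇒≡ i (length u) (proj₁ (split-∧ (i ≡ᵇ length u) ends))) (<⇒≢ i<u)

  lowerBelow : ∀ k → prefixN k l ≤ prefixN k u
  lowerBelow = prefixN-≤-extend (sym sameLength)
    (λ k k≤ → ≤ᵇ⇒≤ _ _ (allB-range⁻ (length u) (λ k → prefixN k l ≤ᵇ prefixN k u) tAbove k k≤))

Parallelogram⇒isParallelogram : ∀ u l → Parallelogram u l → T (isParallelogram u l)
Parallelogram⇒isParallelogram u l P =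
  join-∧ (≡⇒≡ᵇ _ _ sameLength)
    (join-∧ (≡⇒≡ᵇ _ _ sameHeight) (join-∧ (nonzero nonempty) (join-∧ meet above)))
  where
  open Parallelogram P

  nonzero : ∀ {m} → 0 < m → T (not (m ≡ᵇ 0))
  nonzero (s≤s _) = _

  above : T (weaklyAbove u l)
  above = allB-range⁺ (length u) (λ k → prefixN k l ≤ᵇ prefixN k u) (λ k _ → ≤⇒≤ᵇ (lowerBelow k))

  ends : ∀ i j → i ≤ length u → j ≤ length l → T (samePoint (pointAt u i) (pointAt l j)) →
         T ((i ≡ᵇ 0) ∧ (j ≡ᵇ 0)) ⊎ T ((i ≡ᵇ length u) ∧ (j ≡ᵇ length l))
  ends i j i≤ j≤ same with i≡j , sameN ← samePoint⇒sameIndex u l i j i≤ j≤ same | i ≟ 0 | i ≟ length u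
  ... | yes i≡0 | _        = inj₁ (join-∧ (≡⇒≡ᵇ i 0 i≡0) (≡⇒≡ᵇ j 0 (trans (sym i≡j) i≡0)))
  ... | no _    | yes i≡len =
    inj₂ (join-∧ (≡⇒≡ᵇ i _ i≡len) (≡⇒≡ᵇ j _ (trans (sym i≡j) (trans i≡len sameLength))))
  ... | no i≢0  | no i≢len =
    contradiction (trans sameN (cong (λ k → prefixN k l) (sym i≡j)))
                  (apart i (≤∧≢⇒< z≤n (i≢0 ∘′ sym)) (≤∧≢⇒< i≤ i≢len))

  meet : T (meetOnlyAtEnds u l)
  meet = allB-range⁺ (length u) (λ i → allB (meetEntry u l i) (range (length l)))
           (λ i i≤ → allB-range⁺ (length l) (meetEntry u l i) (λ j j≤ → ends⇒entry (ends i j i≤ j≤)))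

Dominated : ℕ → Path → Path → Set
Dominated h a b = length a ≡ length b × (∀ k → prefixN k a ≤ h + prefixN k b) × countN a ≡ h + countN b

private
  ≤-from-sums : ∀ {x y a b} → x + b ≡ y + a → a ≤ b → x ≤ y
  ≤-from-sums {x} {y} {a} {b} x+b≡y+a a≤b =
    +-cancelʳ-≤ b x y (≤-trans (≤-reflexive x+b≡y+a) (+-monoʳ-≤ y a≤b))

Dominated-reverse : ∀ p q → Dominated 0 p q → Dominated 0 (reverse q) (reverse p)
Dominated-reverse p q (len≡ , p≤q , count≡) =
  len≡′ , prefixN-≤-extend len≡′ below , trans (countN-reverse q) (trans (sym count≡) (sym (countN-reverse p)))
  where
  len≡′ : length (reverse q) ≡ length (reverse p)
  len≡′ = trans (length-reverse q) (trans (sym len≡) (sym (length-reverse p)))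

  below : ∀ k → k ≤ length (reverse p) → prefixN k (reverse q) ≤ prefixN k (reverse p)
  below k k≤ = ≤-from-sums
    (trans (prefixN-reverse k m q (trans k+m≡ len≡)) (trans (sym count≡) (sym (prefixN-reverse k m p k+m≡))))
    (p≤q m)
    where
    m = length p ∸ k
    k+m≡ : k + m ≡ length p
    k+m≡ = m+[n∸m]≡n (subst (k ≤_) (length-reverse p) k≤)

Dominated⇒Parallelogram : ∀ w w′ → Dominated 0 w′ w → Parallelogram (N ∷ (w ∷ʳ E)) (E ∷ (w′ ∷ʳ N))
Dominated⇒Parallelogram w w′ (len≡ , w′≤w , count≡) = record
  { sameLength = cong suc (trans (length-∷ʳ w E) (trans (cong suc (sym len≡)) (sym (length-∷ʳ w′ N))))
  ; sameHeight = sameHeight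
  ; nonempty   = s≤s z≤n
  ; apart      = apart
  ; lowerBelow = lowerBelow
  }
  where
  open ≡-Reasoning
  sameHeight : countN (N ∷ (w ∷ʳ E)) ≡ countN (E ∷ (w′ ∷ʳ N))
  sameHeight = begin
    suc (countN (w ∷ʳ E))  ≡⟨ cong suc (countN-++ w (E ∷ [])) ⟩
    suc (countN w + 0)     ≡⟨ cong suc (+-identityʳ _) ⟩
    suc (countN w)         ≡⟨ cong suc count≡ ⟨
    suc (countN w′)        ≡⟨ +-comm 1 (countN w′) ⟩
    countN w′ + 1          ≡⟨ countN-++ w′ (N ∷ []) ⟨
    countN (w′ ∷ʳ N)       ∎

  apart : ∀ i → 0 < i → i < length (N ∷ (w ∷ʳ E)) → prefixN i (N ∷ (w ∷ʳ E)) ≢ prefixN i (E ∷ (w′ ∷ʳ N))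
  apart (suc k) _ (s≤s k<) heights≡ = <-irrefl refl (≤-trans (≤-reflexive overtakes) (w′≤w k))
    where
    k≤ : k ≤ length w
    k≤ = ≤-pred (subst (suc k ≤_) (length-∷ʳ w E) k<)
    overtakes : suc (prefixN k w) ≡ prefixN k w′
    overtakes = begin
      suc (prefixN k w)        ≡⟨ cong suc (prefixN-∷ʳ k w E k≤) ⟨
      suc (prefixN k (w ∷ʳ E)) ≡⟨ heights≡ ⟩
      prefixN k (w′ ∷ʳ N)      ≡⟨ prefixN-∷ʳ k w′ N (subst (k ≤_) (sym len≡) k≤) ⟩
      prefixN k w′             ∎

  lowerBelow : ∀ k → prefixN k (E ∷ (w′ ∷ʳ N)) ≤ prefixN k (N ∷ (w ∷ʳ E))
  lowerBelow zero    = z≤n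
  lowerBelow (suc k) = ≤-trans (prefixN-∷ʳ-≤ k w′ N) (s≤s (≤-trans (w′≤w k) (≤-prefixN-∷ʳ k w E)))

module _ (w w′ : Path) {z z′ : Step} (len≡ : length w ≡ length w′)
         (P : Parallelogram (N ∷ (w ∷ʳ z)) (E ∷ (w′ ∷ʳ z′))) where
  open Parallelogram P

  innerBelow : ∀ k → k ≤ length w → prefixN k w′ ≤ prefixN k w
  innerBelow k k≤ =
    ≤-pred (≤∧≢⇒< below (λ overtakes → apart (suc k) (s≤s z≤n) k+1< (trans uN (trans (sym overtakes) (sym lN)))))
    where
    uN : prefixN (suc k) (N ∷ (w ∷ʳ z)) ≡ suc (prefixN k w)
    uN = cong suc (prefixN-∷ʳ k w z k≤)
    lN : prefixN (suc k) (E ∷ (w′ ∷ʳ z′)) ≡ prefixN k w′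
    lN = prefixN-∷ʳ k w′ z′ (subst (k ≤_) len≡ k≤)
    below : prefixN k w′ ≤ suc (prefixN k w)
    below = subst₂ _≤_ lN uN (lowerBelow (suc k))
    k+1< : suc k < length (N ∷ (w ∷ʳ z))
    k+1< = s≤s (subst (suc k ≤_) (sym (length-∷ʳ w z)) (s≤s k≤))

  countBelow : countN w′ ≤ countN w
  countBelow = subst₂ _≤_ (prefixN-all _ w′ (≤-reflexive (sym len≡))) (prefixN-all _ w ≤-refl)
                          (innerBelow (length w) ≤-refl)

  -- The last steps are forced: an N at the end of the upper path (or an E at the end of the lower one)
  -- would leave the lower path strictly below at the end point.
  lastSteps : z ≡ E × z′ ≡ N × Dominated 0 w′ w
  lastSteps with finalHeights z z′ heights
    where
    heights : suc (countN w + countN (z ∷ [])) ≡ countN w′ + countN (z′ ∷ [])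
    heights = trans (cong suc (sym (countN-++ w (z ∷ [])))) (trans sameHeight (countN-++ w′ (z′ ∷ [])))

    finalHeights : ∀ z z′ → suc (countN w + countN (z ∷ [])) ≡ countN w′ + countN (z′ ∷ []) →
                   z ≡ E × z′ ≡ N × countN w′ ≡ countN w
    finalHeights E N h = refl , refl , sym (suc-injective (trans (cong suc (sym (+-identityʳ _))) (trans h (+-comm _ 1))))
    finalHeights N z′ h =
      contradiction (≤-trans (≤-reflexive h) (+-mono-≤ countBelow (prefixN-one 1 z′))) (<-irrefl refl)
    finalHeights E E h = contradiction (≤-trans (≤-reflexive h) (+-monoˡ-≤ 0 countBelow)) (<-irrefl refl)
  ... | z≡E , z′≡N , count≡ = z≡E , z′≡N , sym len≡ , prefixN-≤-extend (sym len≡) innerBelow , count≡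

record Inner (n : ℕ) (u l : Path) : Set where
  constructor inner
  field
    w w′      : Path
    upper≡    : u ≡ N ∷ (w ∷ʳ E)
    lower≡    : l ≡ E ∷ (w′ ∷ʳ N)
    dominated : Dominated 0 w′ w
    length-w  : length w ≡ n

decompose : ∀ {n} u l → Parallelogram u l → length u ≡ 2 + n → Inner n u l
decompose [] _ _ ()
decompose (_ ∷ _) [] P _ with () ← Parallelogram.sameLength P
decompose {n} (N ∷ _) (N ∷ _) P len =
  contradiction refl (Parallelogram.apart P 1 (s≤s z≤n) (subst (2 ≤_) (sym len) (m≤m+n 2 n)))
decompose {n} (E ∷ _) (E ∷ _) P len =
  contradiction refl (Parallelogram.apart P 1 (s≤s z≤n) (subst (2 ≤_) (sym len) (m≤m+n 2 n)))
decompose (E ∷ _) (N ∷ _) P _ with () ← Parallelogram.lowerBelow P 1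
decompose (N ∷ u′) (E ∷ l′) P len with initLast u′ | initLast l′
... | [] | _ with () ← len
... | w ∷ʳ′ z | [] with () ← trans (sym (length-∷ʳ w z)) (suc-injective (Parallelogram.sameLength P))
... | w ∷ʳ′ z | w′ ∷ʳ′ z′ with lastSteps w w′ len≡ P
  where
  len≡ : length w ≡ length w′
  len≡ = suc-injective
    (trans (sym (length-∷ʳ w z)) (trans (suc-injective (Parallelogram.sameLength P)) (length-∷ʳ w′ z′)))
...   | refl , refl , dominated =
  inner w w′ refl refl dominated (suc-injective (trans (sym (length-∷ʳ w E)) (suc-injective len)))

data Corridor : ℕ → Path → Path → Set where
  end : Corridor 0 [] []
  NE  : ∀ {h a b} → Corridor h a b → Corridor (suc h) (N ∷ a) (E ∷ b)
  NN  : ∀ {h a b} → Corridor h a b → Corridor h (N ∷ a) (N ∷ b)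
  EE  : ∀ {h a b} → Corridor h a b → Corridor h (E ∷ a) (E ∷ b)
  EN  : ∀ {h a b} → Corridor (suc h) a b → Corridor h (E ∷ a) (N ∷ b)

Corridor-irrelevant : ∀ {h a b} (v w : Corridor h a b) → v ≡ w
Corridor-irrelevant end    end    = refl
Corridor-irrelevant (NE v) (NE w) = cong NE (Corridor-irrelevant v w)
Corridor-irrelevant (NN v) (NN w) = cong NN (Corridor-irrelevant v w)
Corridor-irrelevant (EE v) (EE w) = cong EE (Corridor-irrelevant v w)
Corridor-irrelevant (EN v) (EN w) = cong EN (Corridor-irrelevant v w)

Corridor⇒Dominated : ∀ {h a b} → Corridor h a b → Dominated h a b
Corridor⇒Dominated end = refl , (λ _ → ≤-refl) , refl
Corridor⇒Dominated {suc h} {N ∷ a} {E ∷ b} (NE v) with len≡ , bound , count≡ ← Corridor⇒Dominated v =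
  cong suc len≡ , bound′ , cong suc count≡
  where
  bound′ : ∀ k → prefixN k (N ∷ a) ≤ suc h + prefixN k (E ∷ b)
  bound′ zero    = z≤n
  bound′ (suc k) = s≤s (bound k)
Corridor⇒Dominated {h} {N ∷ a} {N ∷ b} (NN v) with len≡ , bound , count≡ ← Corridor⇒Dominated v =
  cong suc len≡ , bound′ , trans (cong suc count≡) (sym (+-suc h _))
  where
  bound′ : ∀ k → prefixN k (N ∷ a) ≤ h + prefixN k (N ∷ b)
  bound′ zero    = z≤n
  bound′ (suc k) = subst (suc (prefixN k a) ≤_) (sym (+-suc h _)) (s≤s (bound k))
Corridor⇒Dominated {h} {E ∷ a} {E ∷ b} (EE v) with len≡ , bound , count≡ ← Corridor⇒Dominated v =
  cong suc len≡ , bound′ , count≡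
  where
  bound′ : ∀ k → prefixN k (E ∷ a) ≤ h + prefixN k (E ∷ b)
  bound′ zero    = z≤n
  bound′ (suc k) = bound k
Corridor⇒Dominated {h} {E ∷ a} {N ∷ b} (EN v) with len≡ , bound , count≡ ← Corridor⇒Dominated v =
  cong suc len≡ , bound′ , trans count≡ (sym (+-suc h _))
  where
  bound′ : ∀ k → prefixN k (E ∷ a) ≤ h + prefixN k (N ∷ b)
  bound′ zero    = z≤n
  bound′ (suc k) = subst (prefixN k a ≤_) (sym (+-suc h _)) (bound k)

Dominated⇒Corridor : ∀ h a b → Dominated h a b → Corridor h a b
Dominated⇒Corridor zero    []      []      _ = end
Dominated⇒Corridor (suc h) []      []      (_ , _ , ())
Dominated⇒Corridor h       []      (_ ∷ _) (() , _)
Dominated⇒Corridor h       (_ ∷ _) []      (() , _)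
Dominated⇒Corridor zero    (N ∷ a) (E ∷ b) (_ , bound , _) with () ← bound 1
Dominated⇒Corridor (suc h) (N ∷ a) (E ∷ b) (len≡ , bound , count≡) =
  NE (Dominated⇒Corridor h a b (suc-injective len≡ , (λ k → ≤-pred (bound (suc k))) , suc-injective count≡))
Dominated⇒Corridor h (N ∷ a) (N ∷ b) (len≡ , bound , count≡) =
  NN (Dominated⇒Corridor h a b (suc-injective len≡
                               , (λ k → ≤-pred (subst (suc (prefixN k a) ≤_) (+-suc h _) (bound (suc k))))
                               , suc-injective (trans count≡ (+-suc h _))))
Dominated⇒Corridor h (E ∷ a) (E ∷ b) (len≡ , bound , count≡) =
  EE (Dominated⇒Corridor h a b (suc-injective len≡ , (λ k → bound (suc k)) , count≡))
Dominated⇒Corridor h (E ∷ a) (N ∷ b) (len≡ , bound , count≡) =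
  EN (Dominated⇒Corridor (suc h) a b (suc-injective len≡ , (λ k → subst (prefixN k a ≤_) (+-suc h _) (bound (suc k)))
                                     , trans count≡ (+-suc h _)))

pairSize : Forest × Forest → ℕ
pairSize (f , g) = forestSize f + forestSize g

Stack : ℕ → Set
Stack h = Vec (Forest × Forest) (suc h)

weight : ∀ {k} → Vec (Forest × Forest) k → ℕ
weight []      = 0
weight (x ∷ s) = pairSize x + weight s

stepNN : ∀ {h} → Stack h → Stack h
stepNN ((f , g) ∷ s) = ([] , node g ∷ f) ∷ s

stepEE : ∀ {h} → Stack h → Stack h
stepEE ((f , g) ∷ s) = (node f ∷ g , []) ∷ s

stepEN : ∀ {h} → Stack (suc h) → Stack h
stepEN ((f , g) ∷ (f′ , g′) ∷ s) = (node f ∷ f′ , node g ∷ g′) ∷ s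

encode : ∀ {h a b} → Corridor h a b → Stack h
encode end    = ([] , []) ∷ []
encode (NE v) = ([] , []) ∷ encode v
encode (NN v) = stepNN (encode v)
encode (EE v) = stepEE (encode v)
encode (EN v) = stepEN (encode v)

prepend : Step → Step → Path × Path → Path × Path
prepend x y (a , b) = x ∷ a , y ∷ b

-- The fuel is the common length of the two paths.
decode : ∀ {h} → ℕ → Stack h → Path × Path
decode _       (([] , []) ∷ [])                  = [] , []
decode (suc k) (([] , []) ∷ t ∷ s)               = prepend N E (decode k (t ∷ s))
decode (suc k) (([] , node g ∷ f) ∷ s)           = prepend N N (decode k ((f , g) ∷ s))
decode (suc k) ((node f ∷ g , []) ∷ s)           = prepend E E (decode k ((f , g) ∷ s))
decode (suc k) ((node f ∷ f′ , node g ∷ g′) ∷ s) = prepend E N (decode k ((f , g) ∷ (f′ , g′) ∷ s))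
decode zero    _                                 = [] , []

private
  weight-swap : ∀ x y w h → x + y + w + h ≡ y + x + w + h
  weight-swap = solve-∀

  weight-pad : ∀ x y w h → x + y + w + h ≡ x + y + 0 + w + h
  weight-pad = solve-∀

  weight-regroup : ∀ x y x′ y′ w h → suc (x + y + (x′ + y′ + w) + suc h) ≡ suc (x + x′) + suc (y + y′) + w + h
  weight-regroup = solve-∀

length-encode : ∀ {h a b} (v : Corridor h a b) → length a ≡ weight (encode v) + h
length-encode end = refl
length-encode {suc h} (NE v) = trans (cong suc (length-encode v)) (sym (+-suc _ h))
length-encode {h} (NN v) with encode v | length-encode v
... | (f , g) ∷ s | len≡ = cong suc (trans len≡ (weight-swap (forestSize f) (forestSize g) (weight s) h))
length-encode {h} (EE v) with encode v | length-encode v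
... | (f , g) ∷ s | len≡ = cong suc (trans len≡ (weight-pad (forestSize f) (forestSize g) (weight s) h))
length-encode {h} (EN v) with encode v | length-encode v
... | (f , g) ∷ (f′ , g′) ∷ s | len≡ =
  trans (cong suc len≡) (weight-regroup (forestSize f) (forestSize g) (forestSize f′) (forestSize g′) (weight s) h)

leftDepth : Forest → ℕ
leftDepth []           = 0
leftDepth (node c ∷ _) = suc (leftDepth c)

leadingE : Path → ℕ
leadingE (E ∷ p) = suc (leadingE p)
leadingE _       = 0

leadingN : Path → ℕ
leadingN (N ∷ p) = suc (leadingN p)
leadingN _       = 0

leadingE-encode : ∀ {h a b} (v : Corridor h a b) → leadingE a ≡ leftDepth (proj₁ (head (encode v)))
leadingE-encode end    = refl
leadingE-encode (NE v) = refl
leadingE-encode (NN v) with encode v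
... | _ ∷ _ = refl
leadingE-encode (EE v) with encode v | leadingE-encode v
... | _ ∷ _ | ih = cong suc ih
leadingE-encode (EN v) with encode v | leadingE-encode v
... | _ ∷ _ ∷ _ | ih = cong suc ih

leadingN-encode : ∀ {h a b} (v : Corridor h a b) → leadingN b ≡ leftDepth (proj₂ (head (encode v)))
leadingN-encode end    = refl
leadingN-encode (NE v) = refl
leadingN-encode (NN v) with encode v | leadingN-encode v
... | _ ∷ _ | ih = cong suc ih
leadingN-encode (EE v) with encode v
... | _ ∷ _ = refl
leadingN-encode (EN v) with encode v | leadingN-encode v
... | _ ∷ _ ∷ _ | ih = cong suc ih

decode-encode : ∀ {h a b} (v : Corridor h a b) → decode (length a) (encode v) ≡ (a , b)
decode-encode end = refl
decode-encode (NE v) with encode v | decode-encode v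
... | _ ∷ _ | ih = cong (prepend N E) ih
decode-encode (NN v) with encode v | decode-encode v
... | _ ∷ _ | ih = cong (prepend N N) ih
decode-encode (EE v) with encode v | decode-encode v
... | _ ∷ _ | ih = cong (prepend E E) ih
decode-encode (EN v) with encode v | decode-encode v
... | _ ∷ _ ∷ _ | ih = cong (prepend E N) ih

encode-decode : ∀ {h} k (s : Stack h) → weight s + h ≡ k →
                Σ (Corridor h (proj₁ (decode k s)) (proj₂ (decode k s))) (λ v → encode v ≡ s)
encode-decode _ (([] , []) ∷ []) _ = end , refl
encode-decode {suc h} zero (([] , []) ∷ t ∷ s) w≡0 with () ← trans (sym (+-suc _ h)) w≡0
encode-decode zero (([] , node _ ∷ _) ∷ _) ()
encode-decode zero ((node _ ∷ _ , _) ∷ _) ()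
encode-decode {suc h} (suc k) (([] , []) ∷ t ∷ s) w≡
  with v , v↦s ← encode-decode k (t ∷ s) (suc-injective (trans (sym (+-suc _ h)) w≡))
  = NE v , cong (([] , []) ∷_) v↦s
encode-decode {h} (suc k) (([] , node g ∷ f) ∷ s) w≡
  with v , v↦s ← encode-decode k ((f , g) ∷ s)
                   (trans (weight-swap (forestSize f) (forestSize g) (weight s) h) (suc-injective w≡))
  = NN v , cong stepNN v↦s
encode-decode {h} (suc k) ((node f ∷ g , []) ∷ s) w≡
  with v , v↦s ← encode-decode k ((f , g) ∷ s)
                   (trans (weight-pad (forestSize f) (forestSize g) (weight s) h) (suc-injective w≡))
  = EE v , cong stepEE v↦s
encode-decode {h} (suc k) ((node f ∷ f′ , node g ∷ g′) ∷ s) w≡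
  with v , v↦s ← encode-decode k ((f , g) ∷ (f′ , g′) ∷ s)
                   (suc-injective (trans (weight-regroup (forestSize f) (forestSize g) (forestSize f′) (forestSize g′)
                                                         (weight s) h) w≡))
  = EN v , cong stepEN v↦s

record CorridorPair (n α β : ℕ) : Set where
  constructor mkCorridorPair
  field
    above below : Path
    corridor    : Corridor 0 above below
    len         : length above ≡ n
    eastRun     : leadingE above ≡ α
    northRun    : leadingN below ≡ β

CorridorPair-≡ : ∀ {n α β} {P Q : CorridorPair n α β} →
                 CorridorPair.above P ≡ CorridorPair.above Q → CorridorPair.below P ≡ CorridorPair.below Q → P ≡ Q
CorridorPair-≡ {P = mkCorridorPair _ _ v l e r} {mkCorridorPair _ _ v′ l′ e′ r′} refl refl
  rewrite Corridor-irrelevant v v′ | ≡-irrelevant l l′ | ≡-irrelevant e e′ | ≡-irrelevant r r′ = refl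

record DepthPair (n α β : ℕ) : Set where
  constructor mkDepthPair
  field
    left right : Forest
    size       : forestSize left + forestSize right ≡ n
    depthˡ     : leftDepth left ≡ α
    depthʳ     : leftDepth right ≡ β

DepthPair-≡ : ∀ {n α β} {P Q : DepthPair n α β} →
              DepthPair.left P ≡ DepthPair.left Q → DepthPair.right P ≡ DepthPair.right Q → P ≡ Q
DepthPair-≡ {P = mkDepthPair _ _ s d e} {mkDepthPair _ _ s′ d′ e′} refl refl
  rewrite ≡-irrelevant s s′ | ≡-irrelevant d d′ | ≡-irrelevant e e′ = refl

pairSize-encode : ∀ {a b} (v : Corridor 0 a b) → length a ≡ pairSize (head (encode v))
pairSize-encode v with encode v | length-encode v
... | _ ∷ [] | len≡ = trans len≡ (trans (+-identityʳ _) (+-identityʳ _))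

decode-encode₀ : ∀ {a b} (v : Corridor 0 a b) → decode (length a) (head (encode v) ∷ []) ≡ (a , b)
decode-encode₀ v with encode v | decode-encode v
... | _ ∷ [] | a,b = a,b

CorridorPair↔DepthPair : ∀ {n α β} → CorridorPair n α β ↔ DepthPair n α β
CorridorPair↔DepthPair {n} = mk↔ₛ′ toDepth fromDepth toDepth-fromDepth fromDepth-toDepth
  where
  toDepth : ∀ {α β} → CorridorPair n α β → DepthPair n α β
  toDepth (mkCorridorPair _ _ v len eastRun northRun) =
    mkDepthPair (proj₁ (head (encode v))) (proj₂ (head (encode v))) (trans (sym (pairSize-encode v)) len)
      (trans (sym (leadingE-encode v)) eastRun) (trans (sym (leadingN-encode v)) northRun)

  decoded : (x : Forest × Forest) → pairSize x ≡ n → Σ (Corridor 0 _ _) (λ v → encode v ≡ x ∷ [])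
  decoded x size = encode-decode n (x ∷ []) (trans (+-identityʳ _) (trans (+-identityʳ _) size))

  fromDepth : ∀ {α β} → DepthPair n α β → CorridorPair n α β
  fromDepth (mkDepthPair f g size depthˡ depthʳ) = mkCorridorPair _ _ v
      (trans (length-encode v) (trans (cong (λ s → weight s + 0) v↦fg) (trans (+-identityʳ _) (trans (+-identityʳ _) size))))
      (trans (leadingE-encode v) (trans (cong (λ s → leftDepth (proj₁ (head s))) v↦fg) depthˡ))
      (trans (leadingN-encode v) (trans (cong (λ s → leftDepth (proj₂ (head s))) v↦fg) depthʳ))
    where
    v = proj₁ (decoded (f , g) size)
    v↦fg = proj₂ (decoded (f , g) size)

  toDepth-fromDepth : ∀ {α β} (P : DepthPair n α β) → toDepth (fromDepth P) ≡ P
  toDepth-fromDepth (mkDepthPair f g size _ _) =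
    DepthPair-≡ (cong (λ s → proj₁ (head s)) v↦fg) (cong (λ s → proj₂ (head s)) v↦fg)
    where v↦fg = proj₂ (decoded (f , g) size)

  fromDepth-toDepth : ∀ {α β} (P : CorridorPair n α β) → fromDepth (toDepth P) ≡ P
  fromDepth-toDepth (mkCorridorPair a b v len _ _) = CorridorPair-≡ (cong proj₁ decodes) (cong proj₂ decodes)
    where
    decodes : decode n (head (encode v) ∷ []) ≡ (a , b)
    decodes = trans (cong (λ k → decode k (head (encode v) ∷ [])) (sym len)) (decode-encode₀ v)

rotate : Forest → Forest
rotate []           = []
rotate (node c ∷ f) = node f ∷ rotate c

unrotate : Forest → Forest
unrotate []           = []
unrotate (node f ∷ r) = node (unrotate r) ∷ f

unrotate-rotate : ∀ F → unrotate (rotate F) ≡ F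
unrotate-rotate []           = refl
unrotate-rotate (node c ∷ f) = cong (λ c′ → node c′ ∷ f) (unrotate-rotate c)

rotate-unrotate : ∀ F → rotate (unrotate F) ≡ F
rotate-unrotate []           = refl
rotate-unrotate (node f ∷ r) = cong (node f ∷_) (rotate-unrotate r)

length-rotate : ∀ F → length (rotate F) ≡ leftDepth F
length-rotate []           = refl
length-rotate (node c ∷ _) = cong suc (length-rotate c)

forestSize-rotate : ∀ F → forestSize (rotate F) ≡ forestSize F
forestSize-rotate []           = refl
forestSize-rotate (node c ∷ f) = cong suc (trans (cong (forestSize f +_) (forestSize-rotate c)) (+-comm (forestSize f) _))

leftDepth-unrotate : ∀ F → leftDepth (unrotate F) ≡ length F
leftDepth-unrotate F = trans (sym (length-rotate (unrotate F))) (cong length (rotate-unrotate F))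

forestSize-unrotate : ∀ F → forestSize (unrotate F) ≡ forestSize F
forestSize-unrotate F = trans (sym (forestSize-rotate (unrotate F))) (cong forestSize (rotate-unrotate F))

ForestPair-≡ : ∀ {n α β} {P Q : ForestPair n α β} →
               ForestPair.Fe P ≡ ForestPair.Fe Q → ForestPair.Fs P ≡ ForestPair.Fs Q → P ≡ Q
ForestPair-≡ {P = mkFP _ _ d e s} {mkFP _ _ d′ e′ s′} refl refl
  rewrite ≡-irrelevant d d′ | ≡-irrelevant e e′ | ≡-irrelevant s s′ = refl

DepthPair↔ForestPair : ∀ {n α β} → DepthPair n α β ↔ ForestPair n α β
DepthPair↔ForestPair = mk↔ₛ′ toForests fromForests
  (λ (mkFP f g _ _ _) → ForestPair-≡ (rotate-unrotate f) (rotate-unrotate g))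
  (λ (mkDepthPair f g _ _ _) → DepthPair-≡ (unrotate-rotate f) (unrotate-rotate g))
  where
  toForests : ∀ {n α β} → DepthPair n α β → ForestPair n α β
  toForests (mkDepthPair f g size depthˡ depthʳ) =
    mkFP (rotate f) (rotate g) (trans (length-rotate f) depthˡ) (trans (length-rotate g) depthʳ)
      (trans (cong₂ _+_ (forestSize-rotate f) (forestSize-rotate g)) size)

  fromForests : ∀ {n α β} → ForestPair n α β → DepthPair n α β
  fromForests (mkFP f g trees trees′ size) =
    mkDepthPair (unrotate f) (unrotate g) (trans (cong₂ _+_ (forestSize-unrotate f) (forestSize-unrotate g)) size)
      (trans (leftDepth-unrotate f) trees) (trans (leftDepth-unrotate g) trees′)

-- trailingE and trailingN run a helper local to Defs on the reversed path; abstracting over the reversed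
-- path exposes its clauses.
trailingE-∷ʳE : ∀ p → trailingE (p ∷ʳ E) ≡ suc (trailingE p)
trailingE-∷ʳE p with reverse (p ∷ʳ E) | reverse-++ p (E ∷ [])
... | _ | refl = refl

trailingE-∷ʳN : ∀ p → trailingE (p ∷ʳ N) ≡ 0
trailingE-∷ʳN p with reverse (p ∷ʳ N) | reverse-++ p (N ∷ [])
... | _ | refl = refl

trailingN-∷ʳN : ∀ p → trailingN (p ∷ʳ N) ≡ suc (trailingN p)
trailingN-∷ʳN p with reverse (p ∷ʳ N) | reverse-++ p (N ∷ [])
... | _ | refl = refl

trailingN-∷ʳE : ∀ p → trailingN (p ∷ʳ E) ≡ 0
trailingN-∷ʳE p with reverse (p ∷ʳ E) | reverse-++ p (E ∷ [])
... | _ | refl = refl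

trailingE-reverse : ∀ p → trailingE (reverse p) ≡ leadingE p
trailingE-reverse []      = refl
trailingE-reverse (N ∷ p) = trans (cong trailingE (unfold-reverse N p)) (trailingE-∷ʳN (reverse p))
trailingE-reverse (E ∷ p) =
  trans (cong trailingE (unfold-reverse E p)) (trans (trailingE-∷ʳE (reverse p)) (cong suc (trailingE-reverse p)))

trailingN-reverse : ∀ p → trailingN (reverse p) ≡ leadingN p
trailingN-reverse []      = refl
trailingN-reverse (E ∷ p) = trans (cong trailingN (unfold-reverse E p)) (trailingN-∷ʳE (reverse p))
trailingN-reverse (N ∷ p) =
  trans (cong trailingN (unfold-reverse N p)) (trans (trailingN-∷ʳN (reverse p)) (cong suc (trailingN-reverse p)))

trailingE-upper : ∀ w → trailingE (N ∷ (w ∷ʳ E)) ≡ suc (leadingE (reverse w))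
trailingE-upper w = trans (trailingE-∷ʳE (N ∷ w)) (cong suc (begin
  trailingE (N ∷ w)                     ≡⟨ cong trailingE (reverse-involutive (N ∷ w)) ⟨
  trailingE (reverse (reverse (N ∷ w))) ≡⟨ trailingE-reverse (reverse (N ∷ w)) ⟩
  leadingE (reverse (N ∷ w))            ≡⟨ cong leadingE (unfold-reverse N w) ⟩
  leadingE (reverse w ∷ʳ N)             ≡⟨ leadingE-∷ʳN (reverse w) ⟩
  leadingE (reverse w)                  ∎))
  where
  open ≡-Reasoning
  leadingE-∷ʳN : ∀ a → leadingE (a ∷ʳ N) ≡ leadingE a
  leadingE-∷ʳN []      = refl
  leadingE-∷ʳN (N ∷ a) = refl
  leadingE-∷ʳN (E ∷ a) = cong suc (leadingE-∷ʳN a)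

trailingN-lower : ∀ w′ → trailingN (E ∷ (w′ ∷ʳ N)) ≡ suc (leadingN (reverse w′))
trailingN-lower w′ = trans (trailingN-∷ʳN (E ∷ w′)) (cong suc (begin
  trailingN (E ∷ w′)                     ≡⟨ cong trailingN (reverse-involutive (E ∷ w′)) ⟨
  trailingN (reverse (reverse (E ∷ w′))) ≡⟨ trailingN-reverse (reverse (E ∷ w′)) ⟩
  leadingN (reverse (E ∷ w′))            ≡⟨ cong leadingN (unfold-reverse E w′) ⟩
  leadingN (reverse w′ ∷ʳ E)             ≡⟨ leadingN-∷ʳE (reverse w′) ⟩
  leadingN (reverse w′)                  ∎))
  where
  open ≡-Reasoning
  leadingN-∷ʳE : ∀ b → leadingN (b ∷ʳ E) ≡ leadingN b
  leadingN-∷ʳE []      = refl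
  leadingN-∷ʳE (E ∷ b) = refl
  leadingN-∷ʳE (N ∷ b) = cong suc (leadingN-∷ʳE b)

PP-≡ : ∀ {n α β} {P Q : PP n α β} →
       upper (PP.poly P) ≡ upper (PP.poly Q) → lower (PP.poly P) ≡ lower (PP.poly Q) → P ≡ Q
PP-≡ {P = mkPP (pp _ _ v) s t r} {mkPP (pp _ _ v′) s′ t′ r′} refl refl
  rewrite T-irrelevant v v′ | ≡-irrelevant s s′ | ≡-irrelevant t t′ | ≡-irrelevant r r′ = refl

fromInner : ∀ {n α β u l} → Inner n u l → trailingE u ≡ suc α → trailingN l ≡ suc β → CorridorPair n α β
fromInner (inner w w′ upper≡ lower≡ dominated length-w) topRow rightCol =
  mkCorridorPair (reverse w) (reverse w′)
    (Dominated⇒Corridor 0 _ _ (Dominated-reverse w′ w dominated))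
    (trans (length-reverse w) length-w)
    (suc-injective (trans (sym (trailingE-upper w)) (trans (cong trailingE (sym upper≡)) topRow)))
    (suc-injective (trans (sym (trailingN-lower w′)) (trans (cong trailingN (sym lower≡)) rightCol)))

PP↔CorridorPair : ∀ {n α β} → PP n α β ↔ CorridorPair n α β
PP↔CorridorPair {n} = mk↔ₛ′ toCorridor fromCorridor toCorridor-fromCorridor fromCorridor-toCorridor
  where
  innerOf : ∀ {α β} (P : PP n α β) → Inner n (upper (PP.poly P)) (lower (PP.poly P))
  innerOf (mkPP (pp u l valid) semiPer _ _) =
    decompose u l (isParallelogram⇒Parallelogram u l valid) (trans semiPer (+-comm n 2))

  toCorridor : ∀ {α β} → PP n α β → CorridorPair n α β
  toCorridor P = fromInner (innerOf P) (PP.topRow P) (PP.rightCol P)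

  fromCorridor : ∀ {α β} → CorridorPair n α β → PP n α β
  fromCorridor (mkCorridorPair a b v len eastRun northRun) =
    mkPP (pp (N ∷ (reverse a ∷ʳ E)) (E ∷ (reverse b ∷ʳ N))
             (Parallelogram⇒isParallelogram _ _
               (Dominated⇒Parallelogram _ _ (Dominated-reverse a b (Corridor⇒Dominated v)))))
      (begin
        suc (length (reverse a ∷ʳ E)) ≡⟨ cong suc (length-∷ʳ (reverse a) E) ⟩
        2 + length (reverse a)        ≡⟨ cong (2 +_) (trans (length-reverse a) len) ⟩
        2 + n                         ≡⟨ +-comm 2 n ⟩
        n + 2                         ∎)
      (trans (trailingE-upper (reverse a)) (cong suc (trans (cong leadingE (reverse-involutive a)) eastRun)))
      (trans (trailingN-lower (reverse b)) (cong suc (trans (cong leadingN (reverse-involutive b)) northRun)))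
    where open ≡-Reasoning

  toCorridor-fromCorridor : ∀ {α β} (V : CorridorPair n α β) → toCorridor (fromCorridor V) ≡ V
  toCorridor-fromCorridor V@(mkCorridorPair a b _ _ _ _) = CorridorPair-≡
    (trans (cong reverse (sym (∷ʳ-injectiveˡ (reverse a) w (∷-injectiveʳ upper≡)))) (reverse-involutive a))
    (trans (cong reverse (sym (∷ʳ-injectiveˡ (reverse b) w′ (∷-injectiveʳ lower≡)))) (reverse-involutive b))
    where open Inner (innerOf (fromCorridor V))

  fromCorridor-toCorridor : ∀ {α β} (P : PP n α β) → fromCorridor (toCorridor P) ≡ P
  fromCorridor-toCorridor P = PP-≡
    (trans (cong (λ p → N ∷ (p ∷ʳ E)) (reverse-involutive w)) (sym upper≡))
    (trans (cong (λ p → E ∷ (p ∷ʳ N)) (reverse-involutive w′)) (sym lower≡))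
    where open Inner (innerOf P)

corollary6 : (n α β : ℕ) → PP n α β ⤖ ForestPair n α β
corollary6 n α β = ↔⇒⤖ (↔-trans PP↔CorridorPair (↔-trans CorridorPair↔DepthPair DepthPair↔ForestPair))
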